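{- Every finite simple graph $H$ is an induced subgraph of a finite simple graph $G$ with $\Gamma_t(G)=2\gamma_{\rm gr}^{\rm Z}(G)$.
   Context: A total dominating set (TD-set) is a set $D$ such that every vertex has a neighbor in $D$; it is minimal if no proper subset is a TD-set; $\Gamma_t(G)$ is the maximum size of a minimal TD-set. With $N[v]=N(v)\cup\{v\}$, a sequence $(v_1,\ldots,v_k)$ of distinct vertices is a Z-sequence if for every $i\in\{1,\ldots,k\}$, $N(v_i)\setminus\bigcup_{j<i}N[v_j]\ne\emptyset$; $\gamma_{\rm gr}^{\rm Z}(G)$ is the maximum length of a Z-sequence. -}

module Defs where

open import Data.Nat using (ℕ; _≤_; _*_)
open import Data.Bool using (Bool; true; false)
open import Data.Fin using (Fin)
open import Data.Fin.Subset using (Subset; _∈_; _∉_; _⊂_; ∣_∣)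
open import Data.List using (List; length; []; _∷_; _++_)
open import Data.List.Relation.Unary.All using (All)
open import Data.Sum using (_⊎_)
open import Data.List.Relation.Unary.Unique.Propositional using (Unique)
open import Data.Product using (Σ; ∃; _×_; _,_)
open import Relation.Binary.PropositionalEquality using (_≡_)
open import Relation.Nullary using (¬_)
open import Function.Definitions using (Injective)

record Graph : Set where
  field
    n     : ℕ
    adj   : Fin n → Fin n → Bool
    sym   : ∀ u v → adj u v ≡ adj v u
    irrefl : ∀ v → adj v v ≡ false
open Graph public

Adj : (G : Graph) → Fin (n G) → Fin (n G) → Set
Adj G u v = adj G u v ≡ true

record InducedEmbedding (H G : Graph) : Set where
  field
    emb      : Fin (n H) → Fin (n G)
    emb-inj  : Injective _≡_ _≡_ emb
    emb-adj  : ∀ u v → adj G (emb u) (emb v) ≡ adj H u v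

_IsInducedSubgraphOf_ : Graph → Graph → Set
H IsInducedSubgraphOf G = InducedEmbedding H G

IsTDSet : (G : Graph) → Subset (n G) → Set
IsTDSet G D = ∀ v → ∃ λ u → Adj G v u × u ∈ D

IsMinimalTDSet : (G : Graph) → Subset (n G) → Set
IsMinimalTDSet G D = IsTDSet G D × (∀ D′ → D′ ⊂ D → ¬ IsTDSet G D′)

UpperTotalDomNumberIs : (G : Graph) → ℕ → Set
UpperTotalDomNumberIs G k =
  (∃ λ D → IsMinimalTDSet G D × ∣ D ∣ ≡ k) ×
  (∀ D → IsMinimalTDSet G D → ∣ D ∣ ≤ k)

InN : (G : Graph) → Fin (n G) → Fin (n G) → Set
InN G v w = Adj G v w

InNClosed : (G : Graph) → Fin (n G) → Fin (n G) → Set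
InNClosed G v w = (w ≡ v) ⊎ Adj G v w

data ZSeqFrom (G : Graph) : List (Fin (n G)) → List (Fin (n G)) → Set where
  []  : ∀ {prev} → ZSeqFrom G prev []
  _∷_ : ∀ {prev v vs} →
        (∃ λ w → InN G v w × All (λ u → ¬ InNClosed G u w) prev) →
        ZSeqFrom G (prev ++ (v ∷ [])) vs →
        ZSeqFrom G prev (v ∷ vs)

IsZSequence : (G : Graph) → List (Fin (n G)) → Set
IsZSequence G vs = Unique vs × ZSeqFrom G [] vs

ZGrundyNumberIs : (G : Graph) → ℕ → Set
ZGrundyNumberIs G k =
  (∃ λ vs → IsZSequence G vs × length vs ≡ k) ×
  (∀ vs → IsZSequence G vs → length vs ≤ k)

-- Take G = H ⊕ k·K₂ with k = |H| + 1: the join of H with a perfect matching on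
-- 2k vertices. A minimal TD-set of a join that meets both sides contains a TD-set
-- of two vertices (one from each side), so it has at most 2 elements; otherwise it
-- lies on one side, hence has at most max(|H|, 2k) = 2k elements, and the whole
-- matching side attains 2k. In a Z-sequence the first vertex dominates the other
-- side entirely, and afterwards the footprints lie in pairwise different classes
-- (vertices of H, resp. edges of the matching) other than the first vertex's one,
-- so there are at most k steps; the k vertices on one side of the matching, with
-- their partners as footprints, attain k.
module Submission where

open import Defs hiding (sym)
open import Data.Bool using (Bool; true; false)
open import Data.Empty using (⊥-elim)
open import Data.Fin using (Fin; _↑ˡ_; _↑ʳ_; splitAt; join; fromℕ<)
open import Data.Fin.Properties
  using (_≟_; splitAt-↑ˡ; splitAt-↑ʳ; splitAt⁻¹-↑ˡ; splitAt⁻¹-↑ʳ;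
         ↑ˡ-injective; ↑ʳ-injective)
open import Data.Fin.Subset
  using (Subset; _∈_; _∉_; _⊆_; _⊂_; ∣_∣; ⁅_⁆; _∪_; _-_; Nonempty; inside; outside)
  renaming (⊥ to ∅; ⊤ to full)
open import Data.Fin.Subset.Properties
  using (∣p∣≤n; ∣⊥∣≡0; ∣⊤∣≡n; ∣⁅x⁆∣≡1; p⊆q⇒∣p∣≤∣q∣; x∈p⇒∣p-x∣<∣p∣; x∈p∧x≢y⇒x∈p-y;
         ∉⊥; ∈⊤; x∈⁅x⁆; x∈⁅y⁆⇒x≡y; x∈p∪q⁺; x∈p∪q⁻; _∈?_; nonempty?; Empty-unique)
open import Data.List using (List; []; _∷_; _++_; length; map; allFin)
open import Data.List.Properties using (length-map; length-tabulate; map-++)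
open import Data.List.Relation.Unary.All using (All; []; _∷_; tabulate; lookup)
open import Data.List.Relation.Unary.All.Properties using (++⁻ˡ; ++⁻ʳ) renaming (map⁺ to All-map⁺)
open import Data.List.Relation.Unary.Any using (here; there)
open import Data.List.Relation.Unary.AllPairs using (_∷_)
open import Data.List.Relation.Unary.Unique.Propositional using (Unique)
open import Data.List.Relation.Unary.Unique.Propositional.Properties
  using (allFin⁺) renaming (map⁺ to Unique-map⁺)
open import Data.List.Relation.Binary.Disjoint.Propositional using (Disjoint)
open import Data.List.Membership.Propositional using () renaming (_∈_ to _∈ₗ_)
open import Data.List.Membership.Propositional.Properties using (∈-++⁻)
open import Data.Maybe using (Maybe; just; nothing)
open import Data.Nat using (ℕ; suc; _+_; _*_; _⊔_; _≤_; _<_; z≤n; s≤s)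
open import Data.Nat.Properties
  using (≤-trans; ≤-reflexive; ≤-<-trans; m≤m+n; m≤m⊔n; m≤n⊔m; ⊔-lub; +-suc; +-identityʳ;
         +-monoʳ-≤; n≤1+n; *-monoʳ-≤; module ≤-Reasoning)
open import Data.Product using (∃; _×_; _,_)
open import Data.Sum using (_⊎_; inj₁; inj₂; [_,_]′; swap; reduce)
open import Data.Vec using ([]; _∷_) renaming (_++_ to _++ᵥ_; splitAt to splitAtᵥ)
open import Data.Vec.Properties using (lookup-++ˡ; lookup-++ʳ; []=⇒lookup; lookup⇒[]=)
open import Function using (_∘_; const)
open import Function.Bundles using (mk⇔)
open import Relation.Binary.PropositionalEquality using (_≡_; _≢_; refl; sym; trans; cong; cong₂; subst; module ≡-Reasoning)
open import Relation.Nullary using (¬_; yes; no; does)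
open import Relation.Nullary.Decidable using (dec-true; dec-false; does-⇔)

data Split (m l : ℕ) : Fin (m + l) → Set where
  inˡ : (i : Fin m) → Split m l (i ↑ˡ l)
  inʳ : (j : Fin l) → Split m l (m ↑ʳ j)

split : ∀ m l (x : Fin (m + l)) → Split m l x
split m l x with splitAt m x in eq
... | inj₁ i = subst (Split m l) (splitAt⁻¹-↑ˡ eq) (inˡ i)
... | inj₂ j = subst (Split m l) (splitAt⁻¹-↑ʳ eq) (inʳ j)

↑ˡ≢↑ʳ : ∀ {m l} (i : Fin m) (j : Fin l) → i ↑ˡ l ≢ m ↑ʳ j
↑ˡ≢↑ʳ {m} {l} i j e with trans (sym (splitAt-↑ˡ m i l)) (trans (cong (splitAt m) e) (splitAt-↑ʳ m l j))
... | ()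

∣p++q∣≡∣p∣+∣q∣ : ∀ {m l} (p : Subset m) (q : Subset l) → ∣ p ++ᵥ q ∣ ≡ ∣ p ∣ + ∣ q ∣
∣p++q∣≡∣p∣+∣q∣ []            q = refl
∣p++q∣≡∣p∣+∣q∣ (inside  ∷ p) q = cong suc (∣p++q∣≡∣p∣+∣q∣ p q)
∣p++q∣≡∣p∣+∣q∣ (outside ∷ p) q = ∣p++q∣≡∣p∣+∣q∣ p q

∣p∪q∣≤∣p∣+∣q∣ : ∀ {m} (p q : Subset m) → ∣ p ∪ q ∣ ≤ ∣ p ∣ + ∣ q ∣
∣p∪q∣≤∣p∣+∣q∣ []            []            = z≤n
∣p∪q∣≤∣p∣+∣q∣ (inside  ∷ p) (inside  ∷ q) = s≤s (≤-trans (∣p∪q∣≤∣p∣+∣q∣ p q) (+-monoʳ-≤ ∣ p ∣ (n≤1+n ∣ q ∣)))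
∣p∪q∣≤∣p∣+∣q∣ (inside  ∷ p) (outside ∷ q) = s≤s (∣p∪q∣≤∣p∣+∣q∣ p q)
∣p∪q∣≤∣p∣+∣q∣ (outside ∷ p) (inside  ∷ q) = ≤-trans (s≤s (∣p∪q∣≤∣p∣+∣q∣ p q)) (≤-reflexive (sym (+-suc ∣ p ∣ ∣ q ∣)))
∣p∪q∣≤∣p∣+∣q∣ (outside ∷ p) (outside ∷ q) = ∣p∪q∣≤∣p∣+∣q∣ p q

module _ {m l} (p : Subset m) (q : Subset l) where

  ∈-++⁺ˡ : ∀ {i} → i ∈ p → i ↑ˡ l ∈ p ++ᵥ q
  ∈-++⁺ˡ {i} i∈p = lookup⇒[]= _ (p ++ᵥ q) (trans (lookup-++ˡ p q i) ([]=⇒lookup i∈p))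

  ∈-++⁻ˡ : ∀ {i} → i ↑ˡ l ∈ p ++ᵥ q → i ∈ p
  ∈-++⁻ˡ {i} i∈ = lookup⇒[]= i p (trans (sym (lookup-++ˡ p q i)) ([]=⇒lookup i∈))

  ∈-++⁺ʳ : ∀ {j} → j ∈ q → m ↑ʳ j ∈ p ++ᵥ q
  ∈-++⁺ʳ {j} j∈q = lookup⇒[]= _ (p ++ᵥ q) (trans (lookup-++ʳ p q j) ([]=⇒lookup j∈q))

  ∈-++⁻ʳ : ∀ {j} → m ↑ʳ j ∈ p ++ᵥ q → j ∈ q
  ∈-++⁻ʳ {j} j∈ = lookup⇒[]= j q (trans (sym (lookup-++ʳ p q j)) ([]=⇒lookup j∈))

∣Empty∣≡0 : ∀ {m} {p : Subset m} → ¬ Nonempty p → ∣ p ∣ ≡ 0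
∣Empty∣≡0 {m} p-empty = trans (cong ∣_∣ (Empty-unique p-empty)) (∣⊥∣≡0 m)

minimalTDSet-⊆ : ∀ {G D D′} → IsMinimalTDSet G D → D′ ⊆ D → IsTDSet G D′ → D ⊆ D′
minimalTDSet-⊆ {D′ = D′} (_ , minimal) D′⊆D tdD′ {x} x∈D with x ∈? D′
... | yes x∈D′ = x∈D′
... | no  x∉D′ = ⊥-elim (minimal D′ (D′⊆D , x , x∈D , x∉D′) tdD′)

Undominated : (G : Graph) → List (Fin (n G)) → Fin (n G) → Set
Undominated G prev w = All (λ u → ¬ InNClosed G u w) prev

-- Under such a class map the footprints of a Z-sequence have pairwise distinct classes.
NeighbourhoodClosed : (G : Graph) {K : ℕ} → (Fin (n G) → Maybe (Fin K)) → Set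
NeighbourhoodClosed G class =
  ∀ {v w w′ c} → Adj G v w → class w ≡ just c → class w′ ≡ just c → InNClosed G v w′

module _ {G : Graph} {K : ℕ} {class : Fin (n G) → Maybe (Fin K)}
         (closed : NeighbourhoodClosed G class) where

  ZSeqFrom-length≤ : ∀ {prev vs} → ZSeqFrom G prev vs → (avail : Subset K) →
    (∀ {w} → Undominated G prev w → ∃ λ c → class w ≡ just c × c ∈ avail) →
    length vs ≤ ∣ avail ∣
  ZSeqFrom-length≤ [] _ _ = z≤n
  ZSeqFrom-length≤ {prev} {v ∷ _} ((w , v~w , w-undom) ∷ z) avail classify
    with classify w-undom
  ... | c , w∈c , c∈avail =
    ≤-<-trans (ZSeqFrom-length≤ z (avail - c) classify′) (x∈p⇒∣p-x∣<∣p∣ c∈avail)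
    where
    classify′ : ∀ {w′} → Undominated G (prev ++ v ∷ []) w′ → ∃ λ c′ → class w′ ≡ just c′ × c′ ∈ avail - c
    classify′ undom with classify (++⁻ˡ prev undom) | ++⁻ʳ prev undom
    ... | c′ , w′∈c′ , c′∈avail | v≁w′ ∷ [] =
      c′ , w′∈c′ , x∈p∧x≢y⇒x∈p-y c′∈avail
        (λ c′≡c → v≁w′ (closed v~w w∈c (trans w′∈c′ (cong just c′≡c))))

  ZSequence-length≤ : ∀ {v vs} (c₀ : Fin K) → ZSeqFrom G [] (v ∷ vs) →
    (∀ {w} → ¬ InNClosed G v w → ∃ λ c → class w ≡ just c × c ≢ c₀) →
    length (v ∷ vs) ≤ K
  ZSequence-length≤ {v} c₀ (_ ∷ z) classify =
    ≤-<-trans (ZSeqFrom-length≤ z (full - c₀) classify′)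
              (subst (∣ full - c₀ ∣ <_) (∣⊤∣≡n K) (x∈p⇒∣p-x∣<∣p∣ {p = full} (∈⊤ {x = c₀})))
    where
    classify′ : ∀ {w} → Undominated G (v ∷ []) w → ∃ λ c → class w ≡ just c × c ∈ full - c₀
    classify′ (v≁w ∷ []) with classify v≁w
    ... | c , w∈c , c≢c₀ = c , w∈c , x∈p∧x≢y⇒x∈p-y ∈⊤ c≢c₀

inducedMatching-isZSequence : ∀ {G m} (X Y : Fin m → Fin (n G)) →
  (∀ i → Adj G (X i) (Y i)) → (∀ i j → InNClosed G (X j) (Y i) → j ≡ i) →
  IsZSequence G (map X (allFin m))
inducedMatching-isZSequence {G} {m} X Y matched induced =
  Unique-map⁺ X-injective (allFin⁺ m) , zSeqFrom [] (allFin m) (allFin⁺ m) (λ ())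
  where
  X-injective : ∀ {i j} → X i ≡ X j → i ≡ j
  X-injective {i} {j} Xi≡Xj = sym (induced i j (inj₂ (subst (λ x → Adj G x (Y i)) Xi≡Xj (matched i))))

  zSeqFrom : ∀ prev is → Unique is → Disjoint prev is → ZSeqFrom G (map X prev) (map X is)
  zSeqFrom prev []       _             _        = []
  zSeqFrom prev (i ∷ is) (i∉is ∷ uniq) disjoint =
    (Y i , matched i , All-map⁺ (tabulate undominated))
    ∷ subst (λ p → ZSeqFrom G p (map X is)) (map-++ X prev (i ∷ []))
            (zSeqFrom (prev ++ i ∷ []) is uniq disjoint′)
    where
    undominated : ∀ {j} → j ∈ₗ prev → ¬ InNClosed G (X j) (Y i)
    undominated {j} j∈prev Xj≽Yi =
      disjoint (j∈prev , subst (_∈ₗ i ∷ is) (sym (induced i j Xj≽Yi)) (here refl))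

    disjoint′ : Disjoint (prev ++ i ∷ []) is
    disjoint′ (j∈ , j∈is) with ∈-++⁻ prev j∈
    ... | inj₁ j∈prev     = disjoint (j∈prev , there j∈is)
    ... | inj₂ (here refl) = lookup i∉is j∈is refl

joinAdj : (H M : Graph) → Fin (n H) ⊎ Fin (n M) → Fin (n H) ⊎ Fin (n M) → Bool
joinAdj H M (inj₁ a) (inj₁ b) = adj H a b
joinAdj H M (inj₁ _) (inj₂ _) = true
joinAdj H M (inj₂ _) (inj₁ _) = true
joinAdj H M (inj₂ p) (inj₂ q) = adj M p q

joinAdj-sym : ∀ H M s t → joinAdj H M s t ≡ joinAdj H M t s
joinAdj-sym H M (inj₁ a) (inj₁ b) = Graph.sym H a b
joinAdj-sym H M (inj₁ _) (inj₂ _) = refl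
joinAdj-sym H M (inj₂ _) (inj₁ _) = refl
joinAdj-sym H M (inj₂ p) (inj₂ q) = Graph.sym M p q

joinAdj-irrefl : ∀ H M s → joinAdj H M s s ≡ false
joinAdj-irrefl H M (inj₁ a) = irrefl H a
joinAdj-irrefl H M (inj₂ p) = irrefl M p

_⊕_ : Graph → Graph → Graph
H ⊕ M = record
  { n      = n H + n M
  ; adj    = λ u v → joinAdj H M (splitAt (n H) u) (splitAt (n H) v)
  ; sym    = λ u v → joinAdj-sym H M (splitAt (n H) u) (splitAt (n H) v)
  ; irrefl = λ u → joinAdj-irrefl H M (splitAt (n H) u)
  }

module Join (H M : Graph) where

  left : Fin (n H) → Fin (n (H ⊕ M))
  left a = a ↑ˡ n M

  right : Fin (n M) → Fin (n (H ⊕ M))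
  right q = n H ↑ʳ q

  ⊕-adj-left-left : ∀ a b → adj (H ⊕ M) (left a) (left b) ≡ adj H a b
  ⊕-adj-left-left a b = cong₂ (joinAdj H M) (splitAt-↑ˡ (n H) a (n M)) (splitAt-↑ˡ (n H) b (n M))

  ⊕-adj-left-right : ∀ a q → Adj (H ⊕ M) (left a) (right q)
  ⊕-adj-left-right a q = cong₂ (joinAdj H M) (splitAt-↑ˡ (n H) a (n M)) (splitAt-↑ʳ (n H) (n M) q)

  ⊕-adj-right-left : ∀ q a → Adj (H ⊕ M) (right q) (left a)
  ⊕-adj-right-left q a = cong₂ (joinAdj H M) (splitAt-↑ʳ (n H) (n M) q) (splitAt-↑ˡ (n H) a (n M))

  ⊕-adj-right-right : ∀ p q → adj (H ⊕ M) (right p) (right q) ≡ adj M p q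
  ⊕-adj-right-right p q = cong₂ (joinAdj H M) (splitAt-↑ʳ (n H) (n M) p) (splitAt-↑ʳ (n H) (n M) q)

  ⊕-left-induced : H IsInducedSubgraphOf (H ⊕ M)
  ⊕-left-induced = record
    { emb     = left
    ; emb-inj = λ {a} {b} → ↑ˡ-injective (n M) a b
    ; emb-adj = ⊕-adj-left-left
    }

  ⊕-InNClosed-right⁺ : ∀ {p q} → InNClosed M p q → InNClosed (H ⊕ M) (right p) (right q)
  ⊕-InNClosed-right⁺         (inj₁ q≡p) = inj₁ (cong right q≡p)
  ⊕-InNClosed-right⁺ {p} {q} (inj₂ p~q) = inj₂ (trans (⊕-adj-right-right p q) p~q)

  ⊕-InNClosed-right⁻ : ∀ {p q} → InNClosed (H ⊕ M) (right p) (right q) → InNClosed M p q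
  ⊕-InNClosed-right⁻ {p} {q} (inj₁ e)   = inj₁ (↑ʳ-injective (n H) q p e)
  ⊕-InNClosed-right⁻ {p} {q} (inj₂ p~q) = inj₂ (trans (sym (⊕-adj-right-right p q)) p~q)

  ⊕-pair-isTDSet : ∀ a q → IsTDSet (H ⊕ M) (⁅ left a ⁆ ∪ ⁅ right q ⁆)
  ⊕-pair-isTDSet a q u with split (n H) (n M) u
  ... | inˡ b = right q , ⊕-adj-left-right b q , x∈p∪q⁺ (inj₂ (x∈⁅x⁆ (right q)))
  ... | inʳ p = left a  , ⊕-adj-right-left p a , x∈p∪q⁺ (inj₁ (x∈⁅x⁆ (left a)))

  ⊕-minimalTDSet-size : ∀ {D} → IsMinimalTDSet (H ⊕ M) D → ∣ D ∣ ≤ 2 ⊔ n H ⊔ n M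
  ⊕-minimalTDSet-size {D} minD with splitAtᵥ (n H) D
  ... | D₁ , D₂ , refl with nonempty? D₁ | nonempty? D₂
  ... | no D₁-empty | _ = begin
    ∣ D₁ ++ᵥ D₂ ∣       ≡⟨ ∣p++q∣≡∣p∣+∣q∣ D₁ D₂ ⟩
    ∣ D₁ ∣ + ∣ D₂ ∣     ≡⟨ cong (_+ ∣ D₂ ∣) (∣Empty∣≡0 D₁-empty) ⟩
    ∣ D₂ ∣              ≤⟨ ∣p∣≤n D₂ ⟩
    n M                 ≤⟨ m≤n⊔m (2 ⊔ n H) (n M) ⟩
    2 ⊔ n H ⊔ n M       ∎
    where open ≤-Reasoning
  ... | yes _ | no D₂-empty = begin
    ∣ D₁ ++ᵥ D₂ ∣       ≡⟨ ∣p++q∣≡∣p∣+∣q∣ D₁ D₂ ⟩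
    ∣ D₁ ∣ + ∣ D₂ ∣     ≡⟨ cong (∣ D₁ ∣ +_) (∣Empty∣≡0 D₂-empty) ⟩
    ∣ D₁ ∣ + 0          ≡⟨ +-identityʳ ∣ D₁ ∣ ⟩
    ∣ D₁ ∣              ≤⟨ ∣p∣≤n D₁ ⟩
    n H                 ≤⟨ m≤n⊔m 2 (n H) ⟩
    2 ⊔ n H             ≤⟨ m≤m⊔n (2 ⊔ n H) (n M) ⟩
    2 ⊔ n H ⊔ n M       ∎
    where open ≤-Reasoning
  ... | yes (a , a∈D₁) | yes (q , q∈D₂) = begin
    ∣ D₁ ++ᵥ D₂ ∣                    ≤⟨ p⊆q⇒∣p∣≤∣q∣ (minimalTDSet-⊆ {H ⊕ M} minD pair⊆D (⊕-pair-isTDSet a q)) ⟩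
    ∣ ⁅ left a ⁆ ∪ ⁅ right q ⁆ ∣     ≤⟨ ∣p∪q∣≤∣p∣+∣q∣ ⁅ left a ⁆ ⁅ right q ⁆ ⟩
    ∣ ⁅ left a ⁆ ∣ + ∣ ⁅ right q ⁆ ∣ ≡⟨ cong₂ _+_ (∣⁅x⁆∣≡1 (left a)) (∣⁅x⁆∣≡1 (right q)) ⟩
    2                                ≤⟨ m≤m⊔n 2 (n H) ⟩
    2 ⊔ n H                          ≤⟨ m≤m⊔n (2 ⊔ n H) (n M) ⟩
    2 ⊔ n H ⊔ n M                    ∎
    where
    open ≤-Reasoning
    pair⊆D : ⁅ left a ⁆ ∪ ⁅ right q ⁆ ⊆ D₁ ++ᵥ D₂
    pair⊆D x∈ with x∈p∪q⁻ ⁅ left a ⁆ ⁅ right q ⁆ x∈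
    ... | inj₁ x∈a = subst (_∈ D₁ ++ᵥ D₂) (sym (x∈⁅y⁆⇒x≡y (left a) x∈a)) (∈-++⁺ˡ D₁ D₂ a∈D₁)
    ... | inj₂ x∈q = subst (_∈ D₁ ++ᵥ D₂) (sym (x∈⁅y⁆⇒x≡y (right q) x∈q)) (∈-++⁺ʳ D₁ D₂ q∈D₂)

  ⊕-lift-minimalTDSet : ∀ {D} → IsMinimalTDSet M D → Nonempty D →
                        IsMinimalTDSet (H ⊕ M) (∅ ++ᵥ D)
  ⊕-lift-minimalTDSet {D} (tdD , minD) (q₀ , q₀∈D) = td , minimal
    where
    td : IsTDSet (H ⊕ M) (∅ ++ᵥ D)
    td u with split (n H) (n M) u
    ... | inˡ a = right q₀ , ⊕-adj-left-right a q₀ , ∈-++⁺ʳ ∅ D q₀∈D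
    ... | inʳ q with tdD q
    ...   | r , q~r , r∈D = right r , trans (⊕-adj-right-right q r) q~r , ∈-++⁺ʳ ∅ D r∈D

    minimal : ∀ D′ → D′ ⊂ ∅ ++ᵥ D → ¬ IsTDSet (H ⊕ M) D′
    minimal D′ (D′⊆D , x , x∈D , x∉D′) tdD′ with splitAtᵥ (n H) D′
    ... | D′₁ , D′₂ , refl = minD D′₂ (D′₂⊆D , missing) tdD′₂
      where
      no-left : ∀ a → left a ∉ D′₁ ++ᵥ D′₂
      no-left a a∈ = ∉⊥ (∈-++⁻ˡ ∅ D (D′⊆D a∈))

      D′₂⊆D : D′₂ ⊆ D
      D′₂⊆D q∈ = ∈-++⁻ʳ ∅ D (D′⊆D (∈-++⁺ʳ D′₁ D′₂ q∈))

      missing : ∃ λ q → q ∈ D × q ∉ D′₂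
      missing with split (n H) (n M) x
      ... | inˡ a = ⊥-elim (∉⊥ (∈-++⁻ˡ ∅ D x∈D))
      ... | inʳ q = q , ∈-++⁻ʳ ∅ D x∈D , λ q∈ → x∉D′ (∈-++⁺ʳ D′₁ D′₂ q∈)

      tdD′₂ : IsTDSet M D′₂
      tdD′₂ q with tdD′ (right q)
      ... | u , q~u , u∈D′ with split (n H) (n M) u
      ...   | inˡ a = ⊥-elim (no-left a u∈D′)
      ...   | inʳ r = r , trans (sym (⊕-adj-right-right q r)) q~u , ∈-++⁻ʳ D′₁ D′₂ u∈D′

-- k·K₂ on Fin (k + k): the edges are {i ↑ˡ k, k ↑ʳ i}.
module Matching (k : ℕ) where

  partner : Fin (k + k) → Fin (k + k)
  partner = join k k ∘ swap ∘ splitAt k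

  pairIndex : Fin (k + k) → Fin k
  pairIndex = reduce ∘ splitAt k

  partner-↑ˡ : ∀ i → partner (i ↑ˡ k) ≡ k ↑ʳ i
  partner-↑ˡ i = cong (join k k ∘ swap) (splitAt-↑ˡ k i k)

  partner-↑ʳ : ∀ i → partner (k ↑ʳ i) ≡ i ↑ˡ k
  partner-↑ʳ i = cong (join k k ∘ swap) (splitAt-↑ʳ k k i)

  pairIndex-↑ˡ : ∀ i → pairIndex (i ↑ˡ k) ≡ i
  pairIndex-↑ˡ i = cong reduce (splitAt-↑ˡ k i k)

  pairIndex-↑ʳ : ∀ i → pairIndex (k ↑ʳ i) ≡ i
  pairIndex-↑ʳ i = cong reduce (splitAt-↑ʳ k k i)

  partner-involutive : ∀ u → partner (partner u) ≡ u
  partner-involutive u with split k k u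
  ... | inˡ i = trans (cong partner (partner-↑ˡ i)) (partner-↑ʳ i)
  ... | inʳ i = trans (cong partner (partner-↑ʳ i)) (partner-↑ˡ i)

  partner-≢ : ∀ u → partner u ≢ u
  partner-≢ u with split k k u
  ... | inˡ i = λ e → ↑ˡ≢↑ʳ i i (sym (trans (sym (partner-↑ˡ i)) e))
  ... | inʳ i = λ e → ↑ˡ≢↑ʳ i i (trans (sym (partner-↑ʳ i)) e)

  partner-sym : ∀ {u v} → v ≡ partner u → u ≡ partner v
  partner-sym {u} refl = sym (partner-involutive u)

  matching : Graph
  matching = record
    { n      = k + k
    ; adj    = λ u v → does (v ≟ partner u)
    ; sym    = λ u v → does-⇔ (mk⇔ partner-sym partner-sym) (v ≟ partner u) (u ≟ partner v)
    ; irrefl = λ u → dec-false (u ≟ partner u) (partner-≢ u ∘ sym)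
    }

  Adj⇒≡partner : ∀ {u v} → Adj matching u v → v ≡ partner u
  Adj⇒≡partner {u} {v} u~v with v ≟ partner u
  ... | yes v≡partner = v≡partner
  Adj⇒≡partner () | no _

  ≡partner⇒Adj : ∀ {u v} → v ≡ partner u → Adj matching u v
  ≡partner⇒Adj {u} {v} = dec-true (v ≟ partner u)

  pairIndex-≡⇒InNClosed : ∀ u v → pairIndex u ≡ pairIndex v → InNClosed matching u v
  pairIndex-≡⇒InNClosed u v e with split k k u | split k k v
  ... | inˡ i | inˡ j rewrite pairIndex-↑ˡ i | pairIndex-↑ˡ j = inj₁ (cong (_↑ˡ k) (sym e))
  ... | inʳ i | inʳ j rewrite pairIndex-↑ʳ i | pairIndex-↑ʳ j = inj₁ (cong (k ↑ʳ_) (sym e))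
  ... | inˡ i | inʳ j rewrite pairIndex-↑ˡ i | pairIndex-↑ʳ j =
    inj₂ (≡partner⇒Adj (trans (cong (k ↑ʳ_) (sym e)) (sym (partner-↑ˡ i))))
  ... | inʳ i | inˡ j rewrite pairIndex-↑ʳ i | pairIndex-↑ˡ j =
    inj₂ (≡partner⇒Adj (trans (cong (_↑ˡ k) (sym e)) (sym (partner-↑ʳ i))))

  pairs-closed : ∀ {v w w′} → Adj matching v w → pairIndex w ≡ pairIndex w′ → InNClosed matching v w′
  pairs-closed {v} {w} {w′} v~w e with pairIndex-≡⇒InNClosed w w′ e
  ... | inj₁ refl = inj₂ v~w
  ... | inj₂ w~w′ = inj₁ (begin
    w′                  ≡⟨ Adj⇒≡partner w~w′ ⟩
    partner w           ≡⟨ cong partner (Adj⇒≡partner v~w) ⟩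
    partner (partner v) ≡⟨ partner-involutive v ⟩
    v                   ∎)
    where open ≡-Reasoning

  full-minimalTDSet : IsMinimalTDSet matching full
  full-minimalTDSet = (λ u → partner u , ≡partner⇒Adj refl , ∈⊤) , minimal
    where
    minimal : ∀ D′ → D′ ⊂ full → ¬ IsTDSet matching D′
    minimal D′ (_ , x , _ , x∉D′) tdD′ with tdD′ (partner x)
    ... | u , px~u , u∈D′ =
      x∉D′ (subst (_∈ D′) (trans (Adj⇒≡partner px~u) (partner-involutive x)) u∈D′)

module JoinWithMatching (H : Graph) (k : ℕ) where
  open Matching k
  open Join H matching

  G : Graph
  G = H ⊕ matching

  leftClass : Fin (n G) → Maybe (Fin (n H))
  leftClass u = [ just , const nothing ]′ (splitAt (n H) u)

  pairClass : Fin (n G) → Maybe (Fin k)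
  pairClass u = [ const nothing , just ∘ pairIndex ]′ (splitAt (n H) u)

  leftClass-just : ∀ w {c} → leftClass w ≡ just c → w ≡ left c
  leftClass-just w e with splitAt (n H) w in eq
  leftClass-just w refl | inj₁ _ = sym (splitAt⁻¹-↑ˡ eq)
  leftClass-just w ()   | inj₂ _

  pairClass-just : ∀ w {c} → pairClass w ≡ just c → ∃ λ q → w ≡ right q × pairIndex q ≡ c
  pairClass-just w e with splitAt (n H) w in eq
  pairClass-just w ()   | inj₁ _
  pairClass-just w refl | inj₂ q = q , sym (splitAt⁻¹-↑ʳ eq) , refl

  leftClass-closed : NeighbourhoodClosed G leftClass
  leftClass-closed {v} {w} {w′} v~w w∈c w′∈c =
    inj₂ (subst (Adj G v) (trans (leftClass-just w w∈c) (sym (leftClass-just w′ w′∈c))) v~w)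

  pairClass-closed : NeighbourhoodClosed G pairClass
  pairClass-closed {v} {w} {w′} v~w w∈c w′∈c with pairClass-just w w∈c | pairClass-just w′ w′∈c
  ... | q , refl , q∈c | q′ , refl , q′∈c with split (n H) (k + k) v
  ...   | inˡ a = inj₂ (⊕-adj-left-right a q′)
  ...   | inʳ p = ⊕-InNClosed-right⁺
                    (pairs-closed (trans (sym (⊕-adj-right-right p q)) v~w) (trans q∈c (sym q′∈c)))

  zSequence : IsZSequence G (map (right ∘ (_↑ˡ k)) (allFin k))
  zSequence = inducedMatching-isZSequence (right ∘ (_↑ˡ k)) (right ∘ (k ↑ʳ_)) matched induced
    where
    matched : ∀ i → Adj G (right (i ↑ˡ k)) (right (k ↑ʳ i))
    matched i = trans (⊕-adj-right-right _ _) (≡partner⇒Adj (sym (partner-↑ˡ i)))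

    induced : ∀ i j → InNClosed G (right (j ↑ˡ k)) (right (k ↑ʳ i)) → j ≡ i
    induced i j Xj≽Yi with ⊕-InNClosed-right⁻ Xj≽Yi
    ... | inj₁ Yi≡Xj = ⊥-elim (↑ˡ≢↑ʳ j i (sym Yi≡Xj))
    ... | inj₂ Xj~Yi = ↑ʳ-injective k j i (trans (sym (partner-↑ˡ j)) (sym (Adj⇒≡partner Xj~Yi)))

  zSequence-length≤ : n H ≤ k → ∀ {vs} → IsZSequence G vs → length vs ≤ k
  zSequence-length≤ _   {[]}    _       = z≤n
  zSequence-length≤ h≤k {v ∷ _} (_ , z) with split (n H) (k + k) v
  ... | inˡ a = ≤-trans (ZSequence-length≤ leftClass-closed a z classify) h≤k
    where
    classify : ∀ {w} → ¬ InNClosed G (left a) w → ∃ λ c → leftClass w ≡ just c × c ≢ a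
    classify {w} a≁w with split (n H) (k + k) w
    ... | inˡ b = b , cong [ just , const nothing ]′ (splitAt-↑ˡ (n H) b (k + k))
                    , λ b≡a → a≁w (inj₁ (cong left b≡a))
    ... | inʳ q = ⊥-elim (a≁w (inj₂ (⊕-adj-left-right a q)))
  ... | inʳ p = ZSequence-length≤ pairClass-closed (pairIndex p) z classify
    where
    classify : ∀ {w} → ¬ InNClosed G (right p) w → ∃ λ c → pairClass w ≡ just c × c ≢ pairIndex p
    classify {w} p≁w with split (n H) (k + k) w
    ... | inˡ b = ⊥-elim (p≁w (inj₂ (⊕-adj-right-left p b)))
    ... | inʳ q = pairIndex q , cong [ const nothing , just ∘ pairIndex ]′ (splitAt-↑ʳ (n H) (k + k) q)
                , λ e → p≁w (⊕-InNClosed-right⁺ (pairIndex-≡⇒InNClosed p q (sym e)))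

  zGrundyNumber : n H ≤ k → ZGrundyNumberIs G k
  zGrundyNumber h≤k =
    (_ , zSequence , trans (length-map _ (allFin k)) (length-tabulate _)) ,
    λ _ → zSequence-length≤ h≤k

  upperTotalDominationNumber : 0 < k → n H ≤ k → UpperTotalDomNumberIs G (2 * k)
  upperTotalDominationNumber 0<k h≤k =
    (rightSide , ⊕-lift-minimalTDSet full-minimalTDSet (fromℕ< 0<k ↑ˡ k , ∈⊤) , size) ,
    λ _ minD → ≤-trans (⊕-minimalTDSet-size minD) (⊔-lub (⊔-lub (*-monoʳ-≤ 2 0<k) h≤2k) (≤-reflexive k+k≡2k))
    where
    rightSide : Subset (n G)
    rightSide = ∅ {n H} ++ᵥ full

    k+k≡2k : k + k ≡ 2 * k
    k+k≡2k = cong (k +_) (sym (+-identityʳ k))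

    h≤2k : n H ≤ 2 * k
    h≤2k = ≤-trans h≤k (m≤m+n k (k + 0))

    size : ∣ rightSide ∣ ≡ 2 * k
    size = trans (∣p++q∣≡∣p∣+∣q∣ {n H} ∅ full) (trans (cong₂ _+_ (∣⊥∣≡0 (n H)) (∣⊤∣≡n (k + k))) k+k≡2k)

mainTheorem9 : (H : Graph) →
    ∃ λ (G : Graph) → H IsInducedSubgraphOf G ×
      (∃ λ (k : ℕ) → UpperTotalDomNumberIs G (2 * k) × ZGrundyNumberIs G k)
mainTheorem9 H =
  G , ⊕-left-induced , k , upperTotalDominationNumber (s≤s z≤n) h≤k , zGrundyNumber h≤k
  where
  k : ℕ
  k = suc (n H)

  h≤k : n H ≤ k
  h≤k = n≤1+n (n H)

  open Matching k using (matching)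
  open Join H matching using (⊕-left-induced)
  open JoinWithMatching H k
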